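{- The ribbons of a Dyck tableau $T$ are in bijection with the patterns $2^+2$ of $\phi(T)$. Moreover, we get the pattern $2^+2$ itself by reading from left to right the two labels that are linked by the ribbon.
   Context: A Dyck tableau of size $n$ is a Dyck path of size $n$ (the staircase Ferrers diagram $E_n=(n,\dots,1)$ with the boxes of a partition $\mu\subset E_{n-1}$ removed, with $n$ columns) in which each column contains exactly one dot, drawn on a basement of $n+1$ boxes. Every Dyck tableau is built uniquely by successive insertions of dotted boxes: in a tableau of size $k$, one chooses one of the $k+1$ basement boxes (labeled $0,\dots,k$ from left to right), adds a new column with a dot at that place, and, if the new column is to the left of the special box (the right-most dotted box with no box to its South-West; it is always the dot inserted at the previous step), adds a ribbon, i.e. a strip of boxes along the lower border linking the new dot to the special dot, which raises by one box the columns strictly between them. The dot inserted at step $j$ gets label $j$. The history table $H$ of $T$ records, for $j=1,\dots,n$, the label $H[j]$ of the basement box chosen at step $j$. The bijection $\phi$ maps $T$ to the permutation $\sigma$ whose non-inversion table equals $H$, where $NI_\sigma[i]=\#\{j'<j:\ \sigma(j')<\sigma(j)\}$ with $\sigma(j)=i$. Equivalently, starting from $\sigma$: label the columns from left to right by $\sigma(1),\dots,\sigma(n)$ and, for $j=1,\dots,n$, add a dotted box in the column labeled $j$ and, if it is to the left of the dotted box added at step $j-1$, add a ribbon between these two boxes. A pattern $2^+2$ of a permutation $\sigma$ is a sub-word $ab$ of $\sigma$ (with $a$ to the left of $b$) such that $a=b+1$. -}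

module Defs where

open import Data.Nat using (ℕ; zero; suc; _≤?_; _<ᵇ_; _≤ᵇ_)
open import Data.Bool using (Bool; true; false; if_then_else_; _∧_)
open import Data.List using (List; []; _∷_; length; filter)
open import Data.Vec using (Vec; toList)
open import Data.Fin using (Fin; toℕ; _<_) renaming (_<?_ to _<F?_)
open import Data.Fin.Permutation using (Permutation′; _⟨$⟩ʳ_; _⟨$⟩ˡ_)
open import Data.List using (allFin)
open import Data.Product using (Σ; _×_; _,_)
open import Relation.Binary.PropositionalEquality using (_≡_)
open import Relation.Nullary.Decidable using (_×-dec_)

-- Dyck tableaux, modelled through their construction by insertions.
-- Dots / columns carry labels 1..n (label j = dot inserted at step j).

-- A ribbon links the dot inserted at some step (newDot) to the special
-- dot (the dot inserted at the previous step).  We also record the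
-- labels of the columns strictly between them (those raised by one box).
record Ribbon : Set where
  constructor ribbon
  field
    newDot     : ℕ
    specialDot : ℕ
    raised     : List ℕ

open Ribbon public

record Tableau : Set where
  constructor tableau
  field
    columns : List ℕ        -- labels of the dotted columns, left to right
    ribbons : List Ribbon   -- ribbons, most recently added first

open Tableau public

emptyTableau : Tableau
emptyTableau = tableau [] []

insertAt : ℕ → ℕ → List ℕ → List ℕ
insertAt zero    x ys       = x ∷ ys
insertAt (suc i) x []       = x ∷ []
insertAt (suc i) x (y ∷ ys) = y ∷ insertAt i x ys

eqℕ : ℕ → ℕ → Bool
eqℕ zero zero = true
eqℕ (suc m) (suc n) = eqℕ m n
eqℕ _ _ = false

-- 0-based position of label x in a list (length if absent)
indexOf : ℕ → List ℕ → ℕ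
indexOf x [] = zero
indexOf x (y ∷ ys) = if eqℕ x y then zero else suc (indexOf x ys)

-- labels strictly between positions p < q (0-based) in a list
between : ℕ → ℕ → List ℕ → List ℕ
between p q [] = []
between zero zero (y ∷ ys) = []
between zero (suc q) (y ∷ ys) = takeN q ys
  where
  takeN : ℕ → List ℕ → List ℕ
  takeN zero _ = []
  takeN (suc k) [] = []
  takeN (suc k) (z ∷ zs) = z ∷ takeN k zs
between (suc p) zero (y ∷ ys) = []
between (suc p) (suc q) (y ∷ ys) = between p q ys

-- Insertion step: the current tableau has size k (labels 1..k, k+1
-- basement boxes 0..k); choose basement box h, add column with dot
-- labelled k+1 there; if it lies to the left of the special box (the
-- dot labelled k, which exists when k ≥ 1), add a ribbon linking them.
insertStep : ℕ → ℕ → Tableau → Tableau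
insertStep zero h T = tableau (insertAt h 1 (columns T)) (ribbons T)
insertStep (suc k) h T =
  let p    = indexOf (suc k) (columns T)
      cols = insertAt h (suc (suc k)) (columns T)
  in if h ≤ᵇ p
     then tableau cols
            (ribbon (suc (suc k)) (suc k)
               (between (indexOf (suc (suc k)) cols) (indexOf (suc k) cols) cols)
             ∷ ribbons T)
     else tableau cols (ribbons T)

buildFrom : ℕ → Tableau → List ℕ → Tableau
buildFrom k T [] = T
buildFrom k T (h ∷ hs) = buildFrom (suc k) (insertStep k h T) hs

-- The Dyck tableau with history table H (H[j] = entry at index j-1).
build : ∀ {n} → Vec ℕ n → Tableau
build H = buildFrom zero emptyTableau (toList H)

ValidHistory : ∀ {n} → Vec ℕ n → Set
ValidHistory {n} H = (j : Fin n) → Data.Vec.lookup H j Data.Nat.≤ toℕ j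
  where import Data.Vec; import Data.Nat

readRibbon : Tableau → Ribbon → ℕ × ℕ
readRibbon T r =
  if indexOf (newDot r) (columns T) <ᵇ indexOf (specialDot r) (columns T)
  then (newDot r , specialDot r)
  else (specialDot r , newDot r)

-- Permutations of {1..n}: σ : Permutation′ n, value label of position j
-- is suc (toℕ (σ ⟨$⟩ʳ j)).

-- Non-inversion table: NI_σ[i] = #{ j' < j : σ(j') < σ(j) } where σ(j) = i.
-- Here i : Fin n stands for label (toℕ i + 1).
nonInv : ∀ {n} → Permutation′ n → Fin n → ℕ
nonInv {n} σ i =
  length (filter (λ j' → (j' <F? (σ ⟨$⟩ˡ i)) ×-dec ((σ ⟨$⟩ʳ j') <F? i)) (allFin n))

HasNonInvTable : ∀ {n} → Permutation′ n → Vec ℕ n → Set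
HasNonInvTable {n} σ H = (i : Fin n) → nonInv σ i ≡ Data.Vec.lookup H i
  where import Data.Vec

Pattern22 : ∀ {n} → Permutation′ n → Set
Pattern22 {n} σ =
  Σ (Fin n × Fin n) λ { (p , q) → p < q × toℕ (σ ⟨$⟩ʳ p) ≡ suc (toℕ (σ ⟨$⟩ʳ q)) }

patternWord : ∀ {n} (σ : Permutation′ n) → Pattern22 σ → ℕ × ℕ
patternWord σ ((p , q) , _) = (suc (toℕ (σ ⟨$⟩ʳ p)) , suc (toℕ (σ ⟨$⟩ʳ q)))

-- A ribbon is created when the dot j + 2 is inserted weakly left of the dot j + 1, which was inserted
-- last and hence still sits in basement box H[j+1]: so there is one ribbon for each weak descent
-- H[j+2] ≤ H[j+1] of the history, and it links j + 2 on the left to j + 1 on the right.  On the other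
-- side, since u = j + 1 is the only value below v = j + 2 that is not below u, NI[j+2] ≤ NI[j+1]
-- holds exactly when j + 2 stands left of j + 1 in σ, i.e. when (j + 2)(j + 1) is a pattern 2⁺2.
-- Ribbons and patterns are thus both in bijection with the weak descents of H, compatibly with
-- reading their labels from left to right.

module Submission where

open import Defs
open import Data.Bool using (true; false; T)
open import Data.Empty using (⊥-elim)
open import Data.Fin as Fin using (Fin; toℕ; fromℕ<) renaming (zero to fzero; suc to fsuc)
open import Data.Fin.Permutation using (Permutation′; _⟨$⟩ʳ_; _⟨$⟩ˡ_; inverseʳ; inverseˡ; flip)
open import Data.Fin.Properties using (toℕ-fromℕ<; toℕ-injective; toℕ<n)
open import Data.List using (List; []; _∷_; length; lookup; filter; allFin)
open import Data.List.Membership.Propositional using (_∈_)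
open import Data.List.Membership.Propositional.Properties using (∈-lookup; ∈-filter⁺; ∈-allFin)
open import Data.List.Properties using (filter-reject; filter-notAll)
open import Data.List.Relation.Binary.Sublist.Propositional using (⊆-refl)
open import Data.List.Relation.Binary.Sublist.Propositional.Properties using (filter⁺; length-mono-≤)
open import Data.List.Relation.Unary.All as All using (All; []; _∷_)
open import Data.List.Relation.Unary.AllPairs using (AllPairs; []; _∷_)
open import Data.List.Relation.Unary.Any as Any using (Any; here; there)
open import Data.List.Relation.Unary.Any.Properties using (lookup-index)
open import Data.Nat using (ℕ; zero; suc; _+_; _≤_; _<_; _≤ᵇ_; _<ᵇ_; z≤n; s≤s; s≤s⁻¹)
open import Data.Nat.Properties
open import Data.Product using (Σ; _×_; _,_; proj₁; proj₂)
open import Data.Sum using (inj₁; inj₂)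
open import Data.Unit using (⊤; tt)
open import Data.Vec as Vec using (Vec; toList)
open import Data.Vec.Properties using (length-toList)
open import Function using (_∘_)
open import Function.Bundles using (_↔_; Inverse; Injection; mk↔ₛ′)
open import Function.Construct.Composition using (_↔-∘_)
open import Function.Properties.Inverse using (↔⇒↣)
open import Relation.Binary.Definitions using (tri<; tri≈; tri>)
open import Relation.Binary.PropositionalEquality
open import Relation.Nullary using (¬_; yes; no)
open import Relation.Unary using (Decidable)

eqℕ-refl : ∀ x → eqℕ x x ≡ true
eqℕ-refl zero    = refl
eqℕ-refl (suc x) = eqℕ-refl x

eqℕ-≢ : ∀ {x y} → x ≢ y → eqℕ x y ≡ false
eqℕ-≢ {zero}  {zero}  x≢y = ⊥-elim (x≢y refl)
eqℕ-≢ {zero}  {suc y} _   = refl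
eqℕ-≢ {suc x} {zero}  _   = refl
eqℕ-≢ {suc x} {suc y} x≢y = eqℕ-≢ (x≢y ∘ cong suc)

length-insertAt : ∀ i x ys → length (insertAt i x ys) ≡ suc (length ys)
length-insertAt zero    x ys       = refl
length-insertAt (suc i) x []       = refl
length-insertAt (suc i) x (y ∷ ys) = cong suc (length-insertAt i x ys)

All-insertAt : ∀ {P : ℕ → Set} i {x} ys → P x → All P ys → All P (insertAt i x ys)
All-insertAt zero    ys       px pys         = px ∷ pys
All-insertAt (suc i) []       px []          = px ∷ []
All-insertAt (suc i) (y ∷ ys) px (py ∷ pys) = py ∷ All-insertAt i ys px pys

indexOf-insertAt : ∀ i x ys → All (x ≢_) ys → i ≤ length ys → indexOf x (insertAt i x ys) ≡ i
indexOf-insertAt zero    x ys       _             _         rewrite eqℕ-refl x = refl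
indexOf-insertAt (suc i) x (y ∷ ys) (x≢y ∷ x∉ys) (s≤s i≤n) rewrite eqℕ-≢ x≢y =
  cong suc (indexOf-insertAt i x ys x∉ys i≤n)

indexOf-insertAt-shift : ∀ i z x ys → x ≢ z → i ≤ indexOf x ys →
                         indexOf x (insertAt i z ys) ≡ suc (indexOf x ys)
indexOf-insertAt-shift zero    z x ys       x≢z _ rewrite eqℕ-≢ x≢z = refl
indexOf-insertAt-shift (suc i) z x (y ∷ ys) x≢z i<ix with eqℕ x y
... | false = cong suc (indexOf-insertAt-shift i z x ys x≢z (s≤s⁻¹ i<ix))

indexOf-insertAt-< : ∀ i z x y ys → x ≢ z → y ≢ z → indexOf x ys < indexOf y ys →
                     indexOf x (insertAt i z ys) < indexOf y (insertAt i z ys)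
indexOf-insertAt-< zero    z x y ys       x≢z y≢z lt rewrite eqℕ-≢ x≢z | eqℕ-≢ y≢z = s≤s lt
indexOf-insertAt-< (suc i) z x y (w ∷ ws) x≢z y≢z lt with eqℕ x w | eqℕ y w
... | true  | true  = ⊥-elim (<-irrefl refl lt)
... | true  | false = s≤s z≤n
... | false | false = s≤s (indexOf-insertAt-< i z x y ws x≢z y≢z (s≤s⁻¹ lt))

lookup-injectiveOn : ∀ {A : Set} (f : A → ℕ) {xs : List A} → AllPairs (λ x y → f x ≢ f y) xs →
                     ∀ i j → f (lookup xs i) ≡ f (lookup xs j) → i ≡ j
lookup-injectiveOn f (_ ∷ _) fzero fzero _ = refl
lookup-injectiveOn f (fx≢ ∷ _) fzero (fsuc j) eq = ⊥-elim (All.lookup fx≢ (∈-lookup j) eq)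
lookup-injectiveOn f (fx≢ ∷ _) (fsuc i) fzero eq = ⊥-elim (All.lookup fx≢ (∈-lookup i) (sym eq))
lookup-injectiveOn f (_ ∷ distinct) (fsuc i) (fsuc j) eq = cong fsuc (lookup-injectiveOn f distinct i j eq)

module _ {A : Set} {P Q : A → Set} (P? : Decidable P) (Q? : Decidable Q) (P⇒Q : ∀ {x} → P x → Q x) where

  length-filter-mono : ∀ xs → length (filter P? xs) ≤ length (filter Q? xs)
  length-filter-mono xs = length-mono-≤ (filter⁺ P? Q? (λ { refl → P⇒Q }) (⊆-refl {x = xs}))

  filter-filter : ∀ xs → filter P? (filter Q? xs) ≡ filter P? xs
  filter-filter [] = refl
  filter-filter (x ∷ xs) with Q? x
  ... | no ¬qx = trans (filter-filter xs) (sym (filter-reject P? (¬qx ∘ P⇒Q)))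
  ... | yes _ with P? x
  ...   | yes _ = cong (x ∷_) (filter-filter xs)
  ...   | no  _ = filter-filter xs

  length-filter-strict : ∀ {y} xs → y ∈ xs → Q y → ¬ P y → length (filter P? xs) < length (filter Q? xs)
  length-filter-strict xs y∈xs qy ¬py =
    subst (_< length (filter Q? xs)) (cong length (filter-filter xs))
      (filter-notAll P? (filter Q? xs) (Any.map (λ { refl → ¬py }) (∈-filter⁺ Q? y∈xs qy)))

module _ {n : ℕ} (σ : Permutation′ n) {v u : Fin n} (v≡1+u : toℕ v ≡ suc (toℕ u)) where

  private
    u<v : u Fin.< v
    u<v = subst (toℕ u <_) (sym v≡1+u) ≤-refl

    σ⁻¹-injective : ∀ {a b} → σ ⟨$⟩ˡ a ≡ σ ⟨$⟩ˡ b → a ≡ b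
    σ⁻¹-injective = Injection.injective (↔⇒↣ (flip σ))

  -- Every entry left of and below v, except u itself, is left of and below u.
  nonInv-mono : σ ⟨$⟩ˡ v Fin.< σ ⟨$⟩ˡ u → nonInv σ v ≤ nonInv σ u
  nonInv-mono v-left = length-filter-mono _ _ counted-for-u (allFin n)
    where
    counted-for-u : ∀ {j} → j Fin.< σ ⟨$⟩ˡ v × σ ⟨$⟩ʳ j Fin.< v →
                            j Fin.< σ ⟨$⟩ˡ u × σ ⟨$⟩ʳ j Fin.< u
    counted-for-u {j} (j-left , j-below) =
      <-trans j-left v-left , ≤∧≢⇒< (s≤s⁻¹ (subst (toℕ (σ ⟨$⟩ʳ j) <_) v≡1+u j-below)) σj≢u
      where
      σj≢u : toℕ (σ ⟨$⟩ʳ j) ≢ toℕ u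
      σj≢u eq = <-asym v-left (subst (Fin._< σ ⟨$⟩ˡ v) j≡σ⁻¹u j-left)
        where j≡σ⁻¹u = trans (sym (inverseˡ σ)) (cong (σ ⟨$⟩ˡ_) (toℕ-injective eq))

  nonInv-strict : σ ⟨$⟩ˡ u Fin.< σ ⟨$⟩ˡ v → nonInv σ u < nonInv σ v
  nonInv-strict u-left = length-filter-strict _ _ (λ (j-left , j-below) → <-trans j-left u-left , <-trans j-below u<v)
    (allFin n) (∈-allFin (σ ⟨$⟩ˡ u)) (u-left , subst (Fin._< v) (sym (inverseʳ σ)) u<v)
    (λ { (_ , u-below-u) → <-irrefl (cong toℕ (inverseʳ σ)) u-below-u })

  left-if-nonInv-≤ : nonInv σ v ≤ nonInv σ u → σ ⟨$⟩ˡ v Fin.< σ ⟨$⟩ˡ u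
  left-if-nonInv-≤ v≤u with <-cmp (toℕ (σ ⟨$⟩ˡ v)) (toℕ (σ ⟨$⟩ˡ u))
  ... | tri< v-left _ _ = v-left
  ... | tri≈ _ same _   = ⊥-elim (<-irrefl (cong toℕ (sym (σ⁻¹-injective (toℕ-injective same)))) u<v)
  ... | tri> _ _ u-left = ⊥-elim (<⇒≱ (nonInv-strict u-left) v≤u)

-- With h m = H[m+1], a weak descent at m says that the dot m + 2 was inserted weakly left of the dot m + 1.
WeakDescent : (ℕ → ℕ) → ℕ → Set
WeakDescent h k = Σ ℕ λ m → suc m < k × h (suc m) ≤ h m

Links : Ribbon → ℕ → Set
Links r m = newDot r ≡ suc (suc m) × specialDot r ≡ suc m

LastDotAt : (ℕ → ℕ) → ℕ → List ℕ → Set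
LastDotAt h zero    cols = ⊤
LastDotAt h (suc j) cols = indexOf (suc j) cols ≡ h j

record ColumnsInvariant (h : ℕ → ℕ) (k : ℕ) (cols : List ℕ) : Set where
  field
    length≡   : length cols ≡ k
    labels≤   : All (_≤ k) cols
    lastDotAt : LastDotAt h k cols

record LinksDescent (h : ℕ → ℕ) (k : ℕ) (r : Ribbon) : Set where
  constructor _,_
  field
    descent : WeakDescent h k
    links   : Links r (proj₁ descent)

NewDotLeft : List ℕ → Ribbon → Set
NewDotLeft cols r = indexOf (newDot r) cols < indexOf (specialDot r) cols

record RibbonsInvariant (h : ℕ → ℕ) (k : ℕ) (cols : List ℕ) (rs : List Ribbon) : Set where
  field
    specials-distinct : AllPairs (λ r r′ → specialDot r ≢ specialDot r′) rs
    ribbon-descent    : All (LinksDescent h k) rs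
    descent-ribbon    : (d : WeakDescent h k) → Any (λ r → specialDot r ≡ suc (proj₁ d)) rs
    newDot-left       : All (NewDotLeft cols) rs

Invariant : (ℕ → ℕ) → ℕ → Tableau → Set
Invariant h k t = ColumnsInvariant h k (columns t) × RibbonsInvariant h k (columns t) (ribbons t)

WeakDescent-suc : ∀ {h k} → WeakDescent h k → WeakDescent h (suc k)
WeakDescent-suc (m , m+1<k , desc) = m , m<n⇒m<1+n m+1<k , desc

module _ {h : ℕ → ℕ} {k : ℕ} where

  insertColumn : ∀ {cols} → ColumnsInvariant h k cols → h k ≤ k →
                 ColumnsInvariant h (suc k) (insertAt (h k) (suc k) cols)
  insertColumn {cols} C hk≤k = record
    { length≡   = trans (length-insertAt (h k) (suc k) cols) (cong suc length≡)
    ; labels≤   = All-insertAt (h k) cols ≤-refl (All.map m≤n⇒m≤1+n labels≤)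
    ; lastDotAt = indexOf-insertAt (h k) (suc k) cols (All.map (λ y≤k eq → <-irrefl (sym eq) (s≤s y≤k)) labels≤)
                    (subst (h k ≤_) (sym length≡) hk≤k)
    }
    where open ColumnsInvariant C

  private
    linked-labels≤ : ∀ {r} → LinksDescent h k r → newDot r ≤ k × specialDot r < k
    linked-labels≤ ((m , m+1<k , _) , refl , refl) = m+1<k , m+1<k

  ribbons-insertColumn : ∀ x {cols rs} → RibbonsInvariant h k cols rs →
                         RibbonsInvariant h k (insertAt x (suc k) cols) rs
  ribbons-insertColumn x {cols} R = record
    { specials-distinct = specials-distinct
    ; ribbon-descent    = ribbon-descent
    ; descent-ribbon    = descent-ribbon
    ; newDot-left       = All.zipWith (λ (linked , left) → keep linked left) (ribbon-descent , newDot-left)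
    }
    where
    open RibbonsInvariant R
    keep : ∀ {r} → LinksDescent h k r → NewDotLeft cols r → NewDotLeft (insertAt x (suc k) cols) r
    keep linked left with linked-labels≤ linked
    ... | new≤k , special<k = indexOf-insertAt-< x (suc k) _ _ cols
            (λ eq → <-irrefl eq (s≤s new≤k)) (λ eq → <-irrefl eq (m<n⇒m<1+n special<k)) left

  keepRibbons : ∀ {cols rs} → RibbonsInvariant h k cols rs → (∀ m → suc m ≡ k → ¬ h (suc m) ≤ h m) →
                RibbonsInvariant h (suc k) cols rs
  keepRibbons R no-new-descent = record
    { specials-distinct = specials-distinct
    ; ribbon-descent    = All.map (λ (d , links) → WeakDescent-suc d , links) ribbon-descent
    ; descent-ribbon    = λ { (m , m+1<k+1 , desc) → case m+1<k+1 desc }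
    ; newDot-left       = newDot-left
    }
    where
    open RibbonsInvariant R
    case : ∀ {m} → suc m < suc k → h (suc m) ≤ h m → Any (λ r → specialDot r ≡ suc m) _
    case m+1<k+1 desc with m<1+n⇒m<n∨m≡n m+1<k+1
    ... | inj₁ m+1<k = descent-ribbon (_ , m+1<k , desc)
    ... | inj₂ m+1≡k = ⊥-elim (no-new-descent _ m+1≡k desc)

  addRibbon : ∀ {cols rs r} → RibbonsInvariant h (suc k) cols rs → Links r k → h (suc k) ≤ h k →
              NewDotLeft cols r → RibbonsInvariant h (suc (suc k)) cols (r ∷ rs)
  addRibbon {rs = rs} {r} R links desc left = record
    { specials-distinct = All.map special≢ ribbon-descent ∷ specials-distinct
    ; ribbon-descent    = ((k , ≤-refl , desc) , links)
                          ∷ All.map (λ (d , links) → WeakDescent-suc d , links) ribbon-descent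
    ; descent-ribbon    = λ { (m , m+1<k+2 , desc) → case m+1<k+2 desc }
    ; newDot-left       = left ∷ newDot-left
    }
    where
    open RibbonsInvariant R
    special≢ : ∀ {r′} → LinksDescent h (suc k) r′ → specialDot r ≢ specialDot r′
    special≢ ((_ , m+1<k+1 , _) , _ , refl) eq = <-irrefl (trans (sym eq) (proj₂ links)) m+1<k+1
    case : ∀ {m} → suc m < suc (suc k) → h (suc m) ≤ h m → Any (λ r → specialDot r ≡ suc m) (r ∷ rs)
    case m+1<k+2 desc with m<1+n⇒m<n∨m≡n m+1<k+2
    ... | inj₁ m+1<k+1 = there (descent-ribbon (_ , m+1<k+1 , desc))
    ... | inj₂ refl    = here (proj₂ links)

step : ∀ {h k t} → Invariant h k t → h k ≤ k → Invariant h (suc k) (insertStep k (h k) t)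
step {h} {zero} (C , R) hk≤k = insertColumn C hk≤k , keepRibbons (ribbons-insertColumn (h 0) R) λ _ ()
step {h} {suc k} {t} (C , R) hk≤k with h (suc k) ≤ᵇ indexOf (suc k) (columns t) in test
... | true  = insertColumn C hk≤k , addRibbon (ribbons-insertColumn (h (suc k)) R) (refl , refl) descent left
  where
  cols = columns t
  cols′ = insertAt (h (suc k)) (suc (suc k)) cols
  new-left-of-special : h (suc k) ≤ indexOf (suc k) cols
  new-left-of-special = ≤ᵇ⇒≤ _ _ (subst T (sym test) tt)
  descent : h (suc k) ≤ h k
  descent = subst (h (suc k) ≤_) (ColumnsInvariant.lastDotAt C) new-left-of-special
  left : indexOf (suc (suc k)) cols′ < indexOf (suc k) cols′
  left = begin-strict
    indexOf (suc (suc k)) cols′ ≡⟨ ColumnsInvariant.lastDotAt (insertColumn C hk≤k) ⟩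
    h (suc k)                   ≤⟨ new-left-of-special ⟩
    indexOf (suc k) cols        <⟨ n<1+n _ ⟩
    suc (indexOf (suc k) cols)  ≡⟨ indexOf-insertAt-shift _ _ (suc k) cols (1+n≢n ∘ sym) new-left-of-special ⟨
    indexOf (suc k) cols′       ∎
    where open ≤-Reasoning
... | false = insertColumn C hk≤k , keepRibbons (ribbons-insertColumn (h (suc k)) R) no-descent
  where
  no-descent : ∀ m → suc m ≡ suc k → ¬ h (suc m) ≤ h m
  no-descent _ refl desc = subst T test (≤⇒≤ᵇ (subst (h (suc k) ≤_) (sym (ColumnsInvariant.lastDotAt C)) desc))

-- Total indexing, with junk value 0 past the end.
at : List ℕ → ℕ → ℕ
at []       _       = 0
at (x ∷ xs) zero    = x
at (x ∷ xs) (suc j) = at xs j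

buildFrom-invariant : ∀ {h k t} hs → Invariant h k t → (∀ j → at hs j ≡ h (k + j)) →
                      (∀ j → j < length hs → h (k + j) ≤ k + j) → Invariant h (k + length hs) (buildFrom k t hs)
buildFrom-invariant {h} {k} {t} []       I _      _     = subst (λ k′ → Invariant h k′ t) (sym (+-identityʳ k)) I
buildFrom-invariant {h} {k} {t} (x ∷ hs) I hs≡h valid =
  subst (λ k′ → Invariant h k′ (buildFrom (suc k) (insertStep k x t) hs)) (sym (+-suc k (length hs)))
    (buildFrom-invariant hs I′ (λ j → trans (hs≡h (suc j)) (cong h (+-suc k j)))
       (λ j j<n → subst (λ i → h i ≤ i) (+-suc k j) (valid (suc j) (s≤s j<n))))
  where
  x≡hk : x ≡ h k
  x≡hk = trans (hs≡h 0) (cong h (+-identityʳ k))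
  I′ : Invariant h (suc k) (insertStep k x t)
  I′ = subst (λ y → Invariant h (suc k) (insertStep k y t)) (sym x≡hk)
         (step I (subst (λ i → h i ≤ i) (+-identityʳ k) (valid 0 (s≤s z≤n))))

emptyTableau-invariant : ∀ h → Invariant h 0 emptyTableau
emptyTableau-invariant h =
  record { length≡ = refl ; labels≤ = [] ; lastDotAt = tt } ,
  record { specials-distinct = [] ; ribbon-descent = [] ; descent-ribbon = λ () ; newDot-left = [] }

at-toList : ∀ {n} (H : Vec ℕ n) (i : Fin n) → at (toList H) (toℕ i) ≡ Vec.lookup H i
at-toList (x Vec.∷ H) fzero    = refl
at-toList (x Vec.∷ H) (fsuc i) = at-toList H i

build-invariant : ∀ {n} (H : Vec ℕ n) → ValidHistory H → Invariant (at (toList H)) n (build H)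
build-invariant H valid = subst (λ k → Invariant (at (toList H)) k (build H)) (length-toList H)
  (buildFrom-invariant (toList H) (emptyTableau-invariant _) (λ _ → refl) valid′)
  where
  valid′ : ∀ j → j < length (toList H) → at (toList H) j ≤ j
  valid′ j j<len = subst (λ i → at (toList H) i ≤ i) (toℕ-fromℕ< j<n)
    (subst (_≤ toℕ i) (sym (at-toList H i)) (valid i))
    where
    j<n = subst (j <_) (length-toList H) j<len
    i = fromℕ< j<n

WeakDescent-≡ : ∀ {h k} {d d′ : WeakDescent h k} → proj₁ d ≡ proj₁ d′ → d ≡ d′
WeakDescent-≡ {d = m , p , q} {.m , p′ , q′} refl =
  cong₂ (λ p q → m , p , q) (≤-irrelevant p p′) (≤-irrelevant q q′)

Pattern22-≡ : ∀ {n} {σ : Permutation′ n} {x y : Pattern22 σ} → proj₁ x ≡ proj₁ y → x ≡ y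
Pattern22-≡ {x = pq , p<q , e} {.pq , p<q′ , e′} refl =
  cong₂ (λ p<q e → pq , p<q , e) (≤-irrelevant p<q p<q′) (≡-irrelevant e e′)

readRibbon-newDot-left : ∀ t r → NewDotLeft (columns t) r → readRibbon t r ≡ (newDot r , specialDot r)
readRibbon-newDot-left t r left with indexOf (newDot r) (columns t) <ᵇ indexOf (specialDot r) (columns t) | <⇒<ᵇ left
... | true | _ = refl

module _ {h k t} (I : Invariant h k t) where
  open RibbonsInvariant (proj₂ I)

  ribbonDescent : Fin (length (ribbons t)) → WeakDescent h k
  ribbonDescent i = LinksDescent.descent (All.lookup ribbon-descent (∈-lookup i))

  ribbon-links : ∀ i → Links (lookup (ribbons t) i) (proj₁ (ribbonDescent i))
  ribbon-links i = LinksDescent.links (All.lookup ribbon-descent (∈-lookup i))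

  readRibbon-lookup : ∀ i → let m = proj₁ (ribbonDescent i) in
                      readRibbon t (lookup (ribbons t) i) ≡ (suc (suc m) , suc m)
  readRibbon-lookup i =
    trans (readRibbon-newDot-left t (lookup (ribbons t) i) (All.lookup newDot-left (∈-lookup i)))
          (cong₂ _,_ (proj₁ (ribbon-links i)) (proj₂ (ribbon-links i)))

  ribbons↔weakDescents : Fin (length (ribbons t)) ↔ WeakDescent h k
  ribbons↔weakDescents = mk↔ₛ′ ribbonDescent (Any.index ∘ descent-ribbon) to∘from from∘to
    where
    to∘from : ∀ d → ribbonDescent (Any.index (descent-ribbon d)) ≡ d
    to∘from d = WeakDescent-≡ (suc-injective (trans (sym (proj₂ (ribbon-links _))) (lookup-index (descent-ribbon d))))
    from∘to : ∀ i → Any.index (descent-ribbon (ribbonDescent i)) ≡ i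
    from∘to i = lookup-injectiveOn specialDot specials-distinct _ _
                  (trans (lookup-index (descent-ribbon _)) (sym (proj₂ (ribbon-links i))))

module _ {n} (σ : Permutation′ n) {h : ℕ → ℕ} (h≡nonInv : ∀ i → h (toℕ i) ≡ nonInv σ i) where

  private
    toℕ-σ-σ⁻¹ : ∀ i → toℕ (σ ⟨$⟩ʳ (σ ⟨$⟩ˡ i)) ≡ toℕ i
    toℕ-σ-σ⁻¹ i = cong toℕ (inverseʳ σ)

    h-at : ∀ {m} i → toℕ i ≡ m → h m ≡ nonInv σ i
    h-at i refl = h≡nonInv i

  -- The labels m + 2 and m + 1 as elements of Fin n (label = value + 1).
  upper lower : WeakDescent h n → Fin n
  upper (m , m+1<n , _) = fromℕ< m+1<n
  lower (m , m+1<n , _) = fromℕ< (<⇒≤ m+1<n)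

  toℕ-upper : ∀ d → toℕ (upper d) ≡ suc (proj₁ d)
  toℕ-upper (m , m+1<n , _) = toℕ-fromℕ< m+1<n

  toℕ-lower : ∀ d → toℕ (lower d) ≡ proj₁ d
  toℕ-lower (m , m+1<n , _) = toℕ-fromℕ< (<⇒≤ m+1<n)

  descentPattern : WeakDescent h n → Pattern22 σ
  descentPattern d@(_ , _ , desc) =
    (σ ⟨$⟩ˡ upper d , σ ⟨$⟩ˡ lower d) ,
    left-if-nonInv-≤ σ upper≡1+lower
      (subst₂ _≤_ (h-at (upper d) (toℕ-upper d)) (h-at (lower d) (toℕ-lower d)) desc) ,
    trans (toℕ-σ-σ⁻¹ (upper d)) (trans upper≡1+lower (cong suc (sym (toℕ-σ-σ⁻¹ (lower d)))))
    where
    upper≡1+lower : toℕ (upper d) ≡ suc (toℕ (lower d))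
    upper≡1+lower = trans (toℕ-upper d) (cong suc (sym (toℕ-lower d)))

  patternDescent : Pattern22 σ → WeakDescent h n
  patternDescent ((p , q) , p<q , σp≡1+σq) =
    toℕ (σ ⟨$⟩ʳ q) , subst (_< n) σp≡1+σq (toℕ<n _) ,
    subst₂ _≤_ (sym (h-at (σ ⟨$⟩ʳ p) σp≡1+σq)) (sym (h≡nonInv (σ ⟨$⟩ʳ q)))
      (nonInv-mono σ σp≡1+σq (subst₂ Fin._<_ (sym (inverseˡ σ)) (sym (inverseˡ σ)) p<q))

  weakDescents↔patterns : WeakDescent h n ↔ Pattern22 σ
  weakDescents↔patterns = mk↔ₛ′ descentPattern patternDescent to∘from from∘to
    where
    σ⁻¹-fromℕ< : ∀ {m} (m<n : m < n) i → toℕ (σ ⟨$⟩ʳ i) ≡ m → σ ⟨$⟩ˡ fromℕ< m<n ≡ i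
    σ⁻¹-fromℕ< m<n i σi≡m =
      trans (cong (σ ⟨$⟩ˡ_) (toℕ-injective (trans (toℕ-fromℕ< m<n) (sym σi≡m)))) (inverseˡ σ)
    to∘from : ∀ x → descentPattern (patternDescent x) ≡ x
    to∘from ((p , q) , _ , σp≡1+σq) =
      Pattern22-≡ {σ = σ} (cong₂ _,_ (σ⁻¹-fromℕ< σq+1<n p σp≡1+σq)
                                     (σ⁻¹-fromℕ< (<⇒≤ σq+1<n) q refl))
      where σq+1<n = subst (_< n) σp≡1+σq (toℕ<n (σ ⟨$⟩ʳ p))
    from∘to : ∀ d → patternDescent (descentPattern d) ≡ d
    from∘to d = WeakDescent-≡ (trans (toℕ-σ-σ⁻¹ (lower d)) (toℕ-lower d))

  patternWord-descentPattern : ∀ d → patternWord σ (descentPattern d) ≡ (suc (suc (proj₁ d)) , suc (proj₁ d))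
  patternWord-descentPattern d = cong₂ _,_ (cong suc (trans (toℕ-σ-σ⁻¹ (upper d)) (toℕ-upper d)))
                                            (cong suc (trans (toℕ-σ-σ⁻¹ (lower d)) (toℕ-lower d)))

proposition8 : (n : ℕ) (H : Vec ℕ n) → ValidHistory H →
    (σ : Permutation′ n) → HasNonInvTable σ H →
    Σ (Fin (length (ribbons (build H))) ↔ Pattern22 σ) λ f →
      (r : Fin (length (ribbons (build H)))) →
        patternWord σ (Inverse.to f r) ≡ readRibbon (build H) (lookup (ribbons (build H)) r)
proposition8 n H valid σ nonInv≡H =
  weakDescents↔patterns σ h≡nonInv ↔-∘ ribbons↔weakDescents I ,
  λ r → trans (patternWord-descentPattern σ h≡nonInv (ribbonDescent I r)) (sym (readRibbon-lookup I r))
  where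
  I = build-invariant H valid
  h≡nonInv : ∀ i → at (toList H) (toℕ i) ≡ nonInv σ i
  h≡nonInv i = trans (at-toList H i) (sym (nonInv≡H i))
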